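{- Let $\mathbb F$ be a field and $(c_1,\ldots,c_{2m})$ a tuple of natural numbers. Then \[\mathrm{pf}\bigl(\mathrm{SGN}(c_1,\ldots,c_{2m})\bigr)=\mathrm{sgn}(c_1,\ldots,c_{2m}).\]
   Context: For a tuple $(c_1,\ldots,c_n)$ of natural numbers ($n\ge2$), $\mathrm{sgn}(c_1,\ldots,c_n)=0$ if $c_i=c_j$ for some $i<j$, and otherwise $\mathrm{sgn}(c_1,\ldots,c_n)=(-1)^{|\{(i,j):1\le i<j\le n,\ c_i>c_j\}|}$. $\mathrm{SGN}(c_1,\ldots,c_n)$ is the $n\times n$ matrix over $\mathbb F$ with $(i,j)$ entry $\mathrm{sgn}(c_i,c_j)$ (a skew-symmetric matrix). Pfaffian: $\Pi_{2m}\subseteq S_{2m}$ is the set of permutations $\pi$ with $\pi(1)<\pi(3)<\cdots<\pi(2m-1)$ and $\pi(2l-1)<\pi(2l)$ for all $1\le l\le m$; for a skew-symmetric $2m\times2m$ matrix $Y=(y_{i\,j})$, $\mathrm{pf}(Y)=\sum_{\pi\in\Pi_{2m}}\mathrm{sgn}(\pi)\prod_{l=1}^m y_{\pi(2l-1)\,\pi(2l)}$. -}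

module Defs where

open import Level using (Level; _⊔_)
open import Algebra.Bundles using (CommutativeRing)
open import Data.Nat as ℕ using (ℕ; zero; suc; _<ᵇ_; _≡ᵇ_; _%_)
open import Data.Fin as Fin using (Fin; toℕ; combine)
open import Data.Bool using (Bool; true; false; _∧_; not; if_then_else_)
open import Data.List as List using (List; []; _∷_; concatMap; map; filter; foldr; allFin; length)
import Data.List
open import Data.Product using (_×_; _,_; Σ; ∃)
open import Relation.Nullary using (¬_)
open import Relation.Nullary.Decidable using (does; T?)

record Field (c ℓ : Level) : Set (Level.suc (c ⊔ ℓ)) where
  field
    commutativeRing : CommutativeRing c ℓ
  open CommutativeRing commutativeRing public
  field
    0≉1     : ¬ (0# ≈ 1#)
    inverse : ∀ x → ¬ (x ≈ 0#) → Σ Carrier λ y → (x * y) ≈ 1#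

orderedPairs : (n : ℕ) → List (Fin n × Fin n)
orderedPairs n =
  concatMap (λ i → map (λ j → (i , j)) (filter (λ j → Fin._<?_ i j) (allFin n))) (allFin n)

allB : {A : Set} → (A → Bool) → List A → Bool
allB p = foldr (λ a b → p a ∧ b) true

inversions : (n : ℕ) → (Fin n → ℕ) → ℕ
inversions n c = length (filter (λ ij → ℕ._<?_ (c (Data.Product.proj₂ ij)) (c (Data.Product.proj₁ ij))) (orderedPairs n))

distinctB : (n : ℕ) → (Fin n → ℕ) → Bool
distinctB n c = allB (λ ij → not (c (Data.Product.proj₁ ij) ≡ᵇ c (Data.Product.proj₂ ij))) (orderedPairs n)

module _ {c ℓ} (R : CommutativeRing c ℓ) where
  open CommutativeRing R

  sgn : (n : ℕ) → (Fin n → ℕ) → Carrier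
  sgn n t = if distinctB n t
              then (if inversions n t % 2 ≡ᵇ 0 then 1# else - 1#)
              else 0#

  SGN : (n : ℕ) → (Fin n → ℕ) → Fin n → Fin n → Carrier
  SGN n t i j = sgn 2 (λ { Fin.zero → t i ; (Fin.suc _) → t j })

  sumL : List Carrier → Carrier
  sumL = foldr _+_ 0#

  prodL : List Carrier → Carrier
  prodL = foldr _*_ 1#

  allFuns : (k n : ℕ) → List (Fin k → Fin n)
  allFuns zero    n = (λ ()) ∷ []
  allFuns (suc k) n =
    concatMap (λ f → map (λ a → λ { Fin.zero → a ; (Fin.suc i) → f i }) (allFin n)) (allFuns k n)

  -- positions 2l-1 and 2l (1-based), i.e. 2l and 2l+1 (0-based), l : Fin m
  oddPos evenPos : {m : ℕ} → Fin m → Fin (m ℕ.* 2)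
  oddPos  l = combine l Fin.zero
  evenPos l = combine l (Fin.suc Fin.zero)

  -- π ∈ Π_{2m}: π is a permutation of {1,…,2m} (injective self-map of a
  -- finite set), π(1) < π(3) < ⋯ < π(2m-1), and π(2l-1) < π(2l) for all l.
  isΠ : (m : ℕ) → (Fin (m ℕ.* 2) → Fin (m ℕ.* 2)) → Bool
  isΠ m π =
    distinctB (m ℕ.* 2) (λ i → toℕ (π i))
    ∧ allB (λ l → toℕ (π (oddPos l)) <ᵇ toℕ (π (evenPos l))) (allFin m)
    ∧ allB (λ ll → if suc (toℕ (Data.Product.proj₁ ll)) ≡ᵇ toℕ (Data.Product.proj₂ ll)
                     then toℕ (π (oddPos (Data.Product.proj₁ ll))) <ᵇ toℕ (π (oddPos (Data.Product.proj₂ ll)))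
                     else true)
           (orderedPairs m)

  Π : (m : ℕ) → List (Fin (m ℕ.* 2) → Fin (m ℕ.* 2))
  Π m = filter (λ π → T? (isΠ m π)) (allFuns (m ℕ.* 2) (m ℕ.* 2))

  pf : (m : ℕ) → (Fin (m ℕ.* 2) → Fin (m ℕ.* 2) → Carrier) → Carrier
  pf m Y = sumL (map (λ π → sgn (m ℕ.* 2) (λ i → toℕ (π i))
                          * prodL (map (λ l → Y (π (oddPos l)) (π (evenPos l))) (allFin m)))
                     (Π m))

-- Expanding pf(Y) along its first row gives
--   pf(Y) = Σ_b (-1)^b y_{1,b+2} pf(Y without rows and columns 1 and b+2),
-- because the elements of Π_{2m+2} are exactly the pairings of 1 with some b+2 combined with
-- an element of Π_{2m} on the remaining indices, relabelled in order.  For Y = SGN(c) the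
-- minors are again sign matrices, so by induction it suffices to show, for every list d,
--   Σ_b (-1)^b sgn(x, d_b) sgn(d without d_b) = (∏_b sgn(x, d_b) − [|d| even]) · sgn(d),
-- whose right-hand side is sgn(x, d₁, …, d_{2m+1}) when |d| = 2m+1.  Both sides change sign
-- under an adjacent transposition of d, so it is enough to check the identity for sorted d,
-- where it follows by induction on d.

module Submission where

open import Defs
open import Level using (Level)
open import Algebra.Bundles using (CommutativeMonoid; CommutativeRing)
open import Data.Bool.Base using (Bool; true; false; if_then_else_; not; _∧_)
open import Data.Bool.Properties using (T-≡)
open import Data.Empty using (⊥-elim)
open import Data.Nat.Base as ℕ using (ℕ; zero; suc; _<ᵇ_; _≡ᵇ_; _%_)
open import Data.Nat.DivMod using ([m+n]%n≡m%n)
import Data.Nat.Properties as ℕ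
open import Data.Fin.Base as Fin using (Fin; toℕ; punchIn; punchOut)
import Data.Fin.Properties as Fin
open import Data.List.Base using (List; []; _∷_; _++_; [_]; map; foldr; filter; concatMap; tabulate; allFin; length)
open import Data.List.Properties
  using (++-assoc; length-++; length-tabulate; map-++; map-∘; map-tabulate; tabulate-cong; concatMap-cong; concatMap-map; map-concatMap)
open import Data.List.Membership.Propositional using (_∈_; find; lose)
open import Data.List.Membership.Propositional.Properties
  using (∈-allFin; ∈-map⁺; ∈-map⁻; ∈-filter⁺; ∈-filter⁻; ∈-concatMap⁺; ∈-concatMap⁻)
open import Data.List.Relation.Binary.Permutation.Propositional as ↭ using (_↭_)
open import Data.List.Relation.Unary.All as All using (All; []; _∷_)
open import Data.List.Relation.Unary.All.Properties using (++⁺; tabulate⁺)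
open import Data.List.Relation.Unary.Any using (here; there)
open import Data.List.Relation.Unary.Linked using ([]; [-]; _∷_)
open import Data.List.Relation.Unary.Sorted.TotalOrder ℕ.≤-totalOrder using (Sorted)
open import Data.List.Sort ℕ.≤-decTotalOrder using (sort; sort-↭; sort-↗)
open import Data.Product.Base as Product using (∃; _×_; _,_; proj₁; proj₂)
open import Data.Sum.Base using (_⊎_; inj₁; inj₂)
open import Data.Vec.Functional using () renaming (_∷_ to _∷ᵛ_)
open import Function.Base using (_∘_; case_of_)
open import Function.Bundles using (Equivalence)
open import Function.Definitions using (Injective)
open import Relation.Binary.Core using (_Preserves_⟶_)
open import Relation.Binary.Definitions using (tri<; tri≈; tri>)
open import Relation.Binary.PropositionalEquality as ≡ using (_≡_; _≢_; _≗_; refl)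
open import Relation.Nullary.Decidable using (yes; no; does; T?)
open import Relation.Nullary.Negation using (¬_)

data Compareᵇ (x y : ℕ) : Set where
  less    : (x <ᵇ y) ≡ true  → (y <ᵇ x) ≡ false → (x ≡ᵇ y) ≡ false → Compareᵇ x y
  equal   : (x <ᵇ y) ≡ false → (y <ᵇ x) ≡ false → (x ≡ᵇ y) ≡ true  → Compareᵇ x y
  greater : (x <ᵇ y) ≡ false → (y <ᵇ x) ≡ true  → (x ≡ᵇ y) ≡ false → Compareᵇ x y

compareᵇ : ∀ x y → Compareᵇ x y
compareᵇ zero    zero    = equal refl refl refl
compareᵇ zero    (suc y) = less refl refl refl
compareᵇ (suc x) zero    = greater refl refl refl
compareᵇ (suc x) (suc y) with compareᵇ x y
... | less    p q r = less p q r
... | equal   p q r = equal p q r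
... | greater p q r = greater p q r

<ᵇ-irrefl : ∀ x → (x <ᵇ x) ≡ false
<ᵇ-irrefl zero    = refl
<ᵇ-irrefl (suc x) = <ᵇ-irrefl x

[2+k]%2≡k%2 : ∀ k → suc (suc k) % 2 ≡ k % 2
[2+k]%2≡k%2 k = ≡.trans (≡.cong (_% 2) (ℕ.+-comm 2 k)) ([m+n]%n≡m%n k 2)

<⇒<ᵇ≡true : ∀ {x y} → x ℕ.< y → (x <ᵇ y) ≡ true
<⇒<ᵇ≡true x<y = Equivalence.to T-≡ (ℕ.<⇒<ᵇ x<y)

<ᵇ≡true⇒< : ∀ {x y} → (x <ᵇ y) ≡ true → x ℕ.< y
<ᵇ≡true⇒< x<ᵇy = ℕ.<ᵇ⇒< _ _ (Equivalence.from T-≡ x<ᵇy)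

≡⇒≡ᵇ≡true : ∀ {x y} → x ≡ y → (x ≡ᵇ y) ≡ true
≡⇒≡ᵇ≡true x≡y = Equivalence.to T-≡ (ℕ.≡⇒≡ᵇ _ _ x≡y)

≡ᵇ≡true⇒≡ : ∀ {x y} → (x ≡ᵇ y) ≡ true → x ≡ y
≡ᵇ≡true⇒≡ x≡ᵇy = ℕ.≡ᵇ⇒≡ _ _ (Equivalence.from T-≡ x≡ᵇy)

∧-≡true⁻ : ∀ {a b} → (a ∧ b) ≡ true → a ≡ true × b ≡ true
∧-≡true⁻ {true} {true} _ = refl , refl

∧-≡true⁺ : ∀ {a b} → a ≡ true → b ≡ true → (a ∧ b) ≡ true
∧-≡true⁺ refl refl = refl

true-⇔⇒≡ : ∀ {a b} → (a ≡ true → b ≡ true) → (b ≡ true → a ≡ true) → a ≡ b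
true-⇔⇒≡ {true}  {true}  _ _ = refl
true-⇔⇒≡ {true}  {false} a⇒b _ = ≡.sym (a⇒b refl)
true-⇔⇒≡ {false} {true}  _ b⇒a = b⇒a refl
true-⇔⇒≡ {false} {false} _ _ = refl

allB⁻ : ∀ {A : Set} {p : A → Bool} {xs x} → allB p xs ≡ true → x ∈ xs → p x ≡ true
allB⁻ {xs = y ∷ xs} all-p (here refl)   = proj₁ (∧-≡true⁻ all-p)
allB⁻ {p = p} {xs = y ∷ xs} all-p (there x∈xs) = allB⁻ {p = p} (proj₂ (∧-≡true⁻ {p y} all-p)) x∈xs

allB⁺ : ∀ {A : Set} {p : A → Bool} xs → (∀ {x} → x ∈ xs → p x ≡ true) → allB p xs ≡ true
allB⁺ []       p-holds = refl
allB⁺ (y ∷ xs) p-holds = ∧-≡true⁺ (p-holds (here refl)) (allB⁺ xs (p-holds ∘ there))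

∈-orderedPairs⁻ : ∀ {n} {i j : Fin n} → (i , j) ∈ orderedPairs n → i Fin.< j
∈-orderedPairs⁻ {n} ij∈ with find (∈-concatMap⁻ _ {xs = allFin n} ij∈)
... | _ , _ , ij∈row with ∈-map⁻ _ ij∈row
... | _ , j∈ , refl = proj₂ (∈-filter⁻ _ {xs = allFin n} j∈)

∈-orderedPairs⁺ : ∀ {n} {i j : Fin n} → i Fin.< j → (i , j) ∈ orderedPairs n
∈-orderedPairs⁺ {n} {i} {j} i<j =
  ∈-concatMap⁺ _ (lose (∈-allFin i) (∈-map⁺ _ (∈-filter⁺ _ (∈-allFin j) i<j)))

allB-orderedPairs⁻ : ∀ {n} {p : Fin n × Fin n → Bool} → allB p (orderedPairs n) ≡ true →
                     ∀ {i j} → i Fin.< j → p (i , j) ≡ true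
allB-orderedPairs⁻ {p = p} all-p i<j = allB⁻ {p = p} all-p (∈-orderedPairs⁺ i<j)

allB-orderedPairs⁺ : ∀ {n} {p : Fin n × Fin n → Bool} →
                     (∀ {i j} → i Fin.< j → p (i , j) ≡ true) → allB p (orderedPairs n) ≡ true
allB-orderedPairs⁺ {n} p-holds = allB⁺ (orderedPairs n) (λ {(i , j)} ij∈ → p-holds (∈-orderedPairs⁻ ij∈))

not-≡ᵇ⇒≢ : ∀ {x y} → not (x ≡ᵇ y) ≡ true → x ≢ y
not-≡ᵇ⇒≢ x≢ᵇy x≡y with ≡.trans (≡.cong not (≡.sym (≡⇒≡ᵇ≡true x≡y))) x≢ᵇy
... | ()

≢⇒not-≡ᵇ : ∀ {x y} → x ≢ y → not (x ≡ᵇ y) ≡ true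
≢⇒not-≡ᵇ {x} {y} x≢y with x ≡ᵇ y in x≡ᵇy
... | true  = ⊥-elim (x≢y (≡ᵇ≡true⇒≡ x≡ᵇy))
... | false = refl

distinctB⇒injective : ∀ {n k} (π : Fin n → Fin k) → distinctB n (toℕ ∘ π) ≡ true → Injective _≡_ _≡_ π
distinctB⇒injective π distinct {i} {j} πi≡πj with Fin.<-cmp i j
... | tri< i<j _ _ = ⊥-elim (not-≡ᵇ⇒≢ (allB-orderedPairs⁻ distinct i<j) (≡.cong toℕ πi≡πj))
... | tri≈ _ i≡j _ = i≡j
... | tri> _ _ j<i = ⊥-elim (not-≡ᵇ⇒≢ (allB-orderedPairs⁻ distinct j<i) (≡.cong toℕ (≡.sym πi≡πj)))

injective⇒distinctB : ∀ {n k} (π : Fin n → Fin k) → Injective _≡_ _≡_ π → distinctB n (toℕ ∘ π) ≡ true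
injective⇒distinctB π π-inj =
  allB-orderedPairs⁺ (λ i<j → ≢⇒not-≡ᵇ (Fin.<⇒≢ i<j ∘ π-inj ∘ Fin.toℕ-injective))

private
  filter-zero< : ∀ {n m} (f : Fin n → Fin m) →
                 filter (λ j → Fin.zero {m} Fin.<? j) (tabulate (Fin.suc ∘ f)) ≡ tabulate (Fin.suc ∘ f)
  filter-zero< {zero}  f = refl
  filter-zero< {suc n} f = ≡.cong (Fin.suc (f Fin.zero) ∷_) (filter-zero< (f ∘ Fin.suc))

  filter-suc< : ∀ {n m} (i : Fin m) (f : Fin n → Fin m) →
                filter (λ j → Fin.suc i Fin.<? j) (tabulate (Fin.suc ∘ f)) ≡ map Fin.suc (filter (λ j → i Fin.<? j) (tabulate f))
  filter-suc< {zero}  i f = refl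
  filter-suc< {suc n} i f with does (i Fin.<? f Fin.zero)
  ... | true  = ≡.cong (Fin.suc (f Fin.zero) ∷_) (filter-suc< i (f ∘ Fin.suc))
  ... | false = filter-suc< i (f ∘ Fin.suc)

orderedPairs-suc : ∀ n → orderedPairs (suc n) ≡
                   map (Fin.zero ,_) (tabulate Fin.suc) ++ map (Product.map Fin.suc Fin.suc) (orderedPairs n)
orderedPairs-suc n = ≡.cong₂ _++_ (≡.cong (map (Fin.zero ,_)) (filter-zero< (λ j → j))) (begin
  concatMap row (tabulate Fin.suc)               ≡⟨ ≡.cong (concatMap row) (≡.sym (map-tabulate (λ j → j) Fin.suc)) ⟩
  concatMap row (map Fin.suc (allFin n))         ≡⟨ concatMap-map row Fin.suc (allFin n) ⟩
  concatMap (row ∘ Fin.suc) (allFin n)           ≡⟨ concatMap-cong row-suc (allFin n) ⟩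
  concatMap (map suc² ∘ row′) (allFin n)         ≡⟨ ≡.sym (map-concatMap suc² row′ (allFin n)) ⟩
  map suc² (orderedPairs n)                      ∎)
  where
  open ≡.≡-Reasoning
  suc² : Fin n × Fin n → Fin (suc n) × Fin (suc n)
  suc² = Product.map Fin.suc Fin.suc
  row : Fin (suc n) → List (Fin (suc n) × Fin (suc n))
  row i = map (i ,_) (filter (λ j → i Fin.<? j) (allFin (suc n)))
  row′ : Fin n → List (Fin n × Fin n)
  row′ i = map (i ,_) (filter (λ j → i Fin.<? j) (allFin n))
  row-suc : ∀ i → row (Fin.suc i) ≡ map suc² (row′ i)
  row-suc i = begin
    map (Fin.suc i ,_) (filter (λ j → Fin.suc i Fin.<? j) (tabulate Fin.suc))
      ≡⟨ ≡.cong (map (Fin.suc i ,_)) (filter-suc< i (λ j → j)) ⟩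
    map (Fin.suc i ,_) (map Fin.suc (filter (λ j → i Fin.<? j) (allFin n)))
      ≡⟨ ≡.sym (map-∘ (filter (λ j → i Fin.<? j) (allFin n))) ⟩
    map (λ j → Fin.suc i , Fin.suc j) (filter (λ j → i Fin.<? j) (allFin n))
      ≡⟨ map-∘ (filter (λ j → i Fin.<? j) (allFin n)) ⟩
    map suc² (row′ i) ∎

injective⇒preimage : ∀ {n} (g : Fin n → Fin n) → Injective _≡_ _≡_ g → ∀ v → ∃ λ i → g i ≡ v
injective⇒preimage {zero}  g g-inj ()
injective⇒preimage {suc n} g g-inj v with Fin.any? (λ i → g i Fin.≟ v)
... | yes hit = hit
... | no miss = ⊥-elim (ℕ.<-irrefl refl (Fin.injective⇒≤ punchOut-inj))
  where
  g≢v : ∀ i → v ≢ g i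
  g≢v i e = miss (i , ≡.sym e)
  punchOut-inj : Injective _≡_ _≡_ (λ i → punchOut (g≢v i))
  punchOut-inj e = g-inj (Fin.punchOut-injective (g≢v _) (g≢v _) e)

relabel : ∀ {n} → Fin (suc n) → Fin n → Fin (suc (suc n))
relabel b = Fin.suc ∘ punchIn b

punchIn-<ᵇ : ∀ {n} (b : Fin (suc n)) (u v : Fin n) →
             (toℕ (punchIn b u) <ᵇ toℕ (punchIn b v)) ≡ (toℕ u <ᵇ toℕ v)
punchIn-<ᵇ Fin.zero    u           v           = refl
punchIn-<ᵇ (Fin.suc b) Fin.zero    Fin.zero    = refl
punchIn-<ᵇ (Fin.suc b) Fin.zero    (Fin.suc v) = refl
punchIn-<ᵇ (Fin.suc b) (Fin.suc u) Fin.zero    = refl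
punchIn-<ᵇ (Fin.suc b) (Fin.suc u) (Fin.suc v) = punchIn-<ᵇ b u v

relabel-mono-< : ∀ {n} (b : Fin (suc n)) {u v} → u Fin.< v → relabel b u Fin.< relabel b v
relabel-mono-< b u<v = ℕ.s≤s (<ᵇ≡true⇒< (≡.trans (punchIn-<ᵇ b _ _) (<⇒<ᵇ≡true u<v)))

relabel-cancel-< : ∀ {n} (b : Fin (suc n)) {u v} → relabel b u Fin.< relabel b v → u Fin.< v
relabel-cancel-< b (ℕ.s≤s u<v) = <ᵇ≡true⇒< (≡.trans (≡.sym (punchIn-<ᵇ b _ _)) (<⇒<ᵇ≡true u<v))

relabel-injective : ∀ {n} (b : Fin (suc n)) → Injective _≡_ _≡_ (relabel b)
relabel-injective b = Fin.punchIn-injective b _ _ ∘ Fin.suc-injective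

relabel-≢-suc : ∀ {n} (b : Fin (suc n)) u → relabel b u ≢ Fin.suc b
relabel-≢-suc b u = Fin.punchInᵢ≢i b u ∘ Fin.suc-injective

insertPair : ∀ {n} → Fin (suc n) → (Fin n → Fin n) → Fin (suc (suc n)) → Fin (suc (suc n))
insertPair b g Fin.zero              = Fin.zero
insertPair b g (Fin.suc Fin.zero)    = Fin.suc b
insertPair b g (Fin.suc (Fin.suc i)) = relabel b (g i)

insertPair-injective : ∀ {n} (b : Fin (suc n)) {g : Fin n → Fin n} →
                       Injective _≡_ _≡_ g → Injective _≡_ _≡_ (insertPair b g)
insertPair-injective b g-inj {Fin.zero}              {Fin.zero}              _ = refl
insertPair-injective b g-inj {Fin.zero}              {Fin.suc Fin.zero}      ()
insertPair-injective b g-inj {Fin.zero}              {Fin.suc (Fin.suc j)}   ()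
insertPair-injective b g-inj {Fin.suc Fin.zero}      {Fin.zero}              ()
insertPair-injective b g-inj {Fin.suc (Fin.suc i)}   {Fin.zero}              ()
insertPair-injective b g-inj {Fin.suc Fin.zero}      {Fin.suc Fin.zero}      _ = refl
insertPair-injective b g-inj {Fin.suc Fin.zero}      {Fin.suc (Fin.suc j)}   e = ⊥-elim (relabel-≢-suc b _ (≡.sym e))
insertPair-injective b g-inj {Fin.suc (Fin.suc i)}   {Fin.suc Fin.zero}      e = ⊥-elim (relabel-≢-suc b _ e)
insertPair-injective b g-inj {Fin.suc (Fin.suc i)}   {Fin.suc (Fin.suc j)}   e =
  ≡.cong (Fin.suc ∘ Fin.suc) (g-inj (relabel-injective b e))

insertPair-injective⁻ : ∀ {n} (b : Fin (suc n)) {g : Fin n → Fin n} →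
                        Injective _≡_ _≡_ (insertPair b g) → Injective _≡_ _≡_ g
insertPair-injective⁻ b π-inj e =
  Fin.suc-injective (Fin.suc-injective (π-inj (≡.cong (relabel b) e)))

module FoldProperties {c ℓ} (M : CommutativeMonoid c ℓ) where
  open CommutativeMonoid M renaming (refl to ≈-refl; sym to ≈-sym; trans to ≈-trans)
  open import Algebra.Properties.CommutativeMonoid.Sum M public using (sum; sum-remove; sum-cong-≗; sum-cong-≋; ∑-distrib-+; sum-replicate-zero)
  open import Relation.Binary.Reasoning.Setoid setoid

  fold : List Carrier → Carrier
  fold = foldr _∙_ ε

  fold-++ : ∀ xs ys → fold (xs ++ ys) ≈ fold xs ∙ fold ys
  fold-++ []       ys = ≈-sym (identityˡ _)
  fold-++ (x ∷ xs) ys = ≈-trans (∙-congˡ (fold-++ xs ys)) (≈-sym (assoc _ _ _))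

  fold-map-cong : ∀ {A : Set} (xs : List A) {f g : A → Carrier} →
                  (∀ x → f x ≈ g x) → fold (map f xs) ≈ fold (map g xs)
  fold-map-cong []       f≈g = ≈-refl
  fold-map-cong (x ∷ xs) f≈g = ∙-cong (f≈g x) (fold-map-cong xs f≈g)

  fold-concatMap : ∀ {A B : Set} (f : A → List B) (h : B → Carrier) xs →
                   fold (map h (concatMap f xs)) ≈ fold (map (λ x → fold (map h (f x))) xs)
  fold-concatMap f h []       = ≈-refl
  fold-concatMap f h (x ∷ xs) = begin
    fold (map h (f x ++ concatMap f xs))          ≡⟨ ≡.cong fold (map-++ h (f x) (concatMap f xs)) ⟩
    fold (map h (f x) ++ map h (concatMap f xs))  ≈⟨ fold-++ (map h (f x)) _ ⟩
    fold (map h (f x)) ∙ fold (map h (concatMap f xs))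
                                                  ≈⟨ ∙-congˡ (fold-concatMap f h xs) ⟩
    fold (map (λ x → fold (map h (f x))) (x ∷ xs)) ∎

  fold-tabulate : ∀ {n} (h : Fin n → Carrier) → fold (tabulate h) ≡ sum h
  fold-tabulate {zero}  h = refl
  fold-tabulate {suc n} h = ≡.cong (h Fin.zero ∙_) (fold-tabulate (h ∘ Fin.suc))

  fold-allFin : ∀ {n} (h : Fin n → Carrier) → fold (map h (allFin n)) ≡ sum h
  fold-allFin h = ≡.trans (≡.cong fold (map-tabulate (λ i → i) h)) (fold-tabulate h)

  fold-map-allFin : ∀ {A : Set} {n} (c : Fin n → A) (h : A → Carrier) → fold (map h (map c (allFin n))) ≡ sum (h ∘ c)
  fold-map-allFin {n = n} c h = ≡.trans (≡.cong fold (≡.sym (map-∘ {g = h} {f = c} (allFin n)))) (fold-allFin (h ∘ c))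

  fold-filter : ∀ {A : Set} (keep : A → Bool) (w : A → Carrier) xs →
                fold (map w (filter (T? ∘ keep) xs)) ≈ fold (map (λ x → if keep x then w x else ε) xs)
  fold-filter keep w []       = ≈-refl
  fold-filter keep w (x ∷ xs) with keep x
  ... | true  = ∙-congˡ (fold-filter keep w xs)
  ... | false = ≈-trans (fold-filter keep w xs) (≈-sym (identityˡ _))

  fold-sum-comm : ∀ {A : Set} {n} (h : A → Fin n → Carrier) xs →
                  fold (map (λ x → sum (h x)) xs) ≈ sum (λ b → fold (map (λ x → h x b) xs))
  fold-sum-comm {n = n} h []       = ≈-sym (sum-replicate-zero n)
  fold-sum-comm         h (x ∷ xs) =
    ≈-trans (∙-congˡ (fold-sum-comm h xs)) (≈-sym (∑-distrib-+ (h x) (λ b → fold (map (λ x → h x b) xs))))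

  sum-≈ε : ∀ {n} (h : Fin n → Carrier) → (∀ i → h i ≈ ε) → sum h ≈ ε
  sum-≈ε {n} h h≈ε = ≈-trans (sum-cong-≋ h≈ε) (sum-replicate-zero n)

  sum-relabel : ∀ {n} (b : Fin (suc n)) (h : Fin (suc (suc n)) → Carrier) →
                h Fin.zero ≈ ε → h (Fin.suc b) ≈ ε → sum h ≈ sum (h ∘ relabel b)
  sum-relabel b h h0≈ε hb≈ε = begin
    h Fin.zero ∙ sum (h ∘ Fin.suc)                          ≈⟨ ∙-cong h0≈ε (sum-remove {i = b} (h ∘ Fin.suc)) ⟩
    ε ∙ (h (Fin.suc b) ∙ sum (h ∘ relabel b))              ≈⟨ identityˡ _ ⟩
    h (Fin.suc b) ∙ sum (h ∘ relabel b)                    ≈⟨ ∙-congʳ hb≈ε ⟩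
    ε ∙ sum (h ∘ relabel b)                                ≈⟨ identityˡ _ ⟩
    sum (h ∘ relabel b)                                    ∎

  sum-injective : ∀ {n} (g : Fin n → Fin n) → Injective _≡_ _≡_ g →
                  (h : Fin n → Carrier) → sum (h ∘ g) ≈ sum h
  sum-injective {zero}  g g-inj h = ≈-refl
  sum-injective {suc n} g g-inj h with injective⇒preimage g g-inj Fin.zero
  ... | i , gi≡0 = begin
    sum (h ∘ g)                              ≈⟨ sum-remove {i = i} (h ∘ g) ⟩
    h (g i) ∙ sum (h ∘ g ∘ punchIn i)        ≡⟨ ≡.cong₂ _∙_ (≡.cong h gi≡0) (sum-cong-≗ (λ j → ≡.cong h (≡.sym (Fin.punchIn-punchOut (g≢0 j))))) ⟩
    h Fin.zero ∙ sum (h ∘ Fin.suc ∘ g′)      ≈⟨ ∙-congˡ (sum-injective g′ g′-inj (h ∘ Fin.suc)) ⟩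
    sum h                                    ∎
    where
    g≢0 : ∀ j → Fin.zero ≢ g (punchIn i j)
    g≢0 j e = Fin.punchInᵢ≢i i j (g-inj (≡.trans (≡.sym e) (≡.sym gi≡0)))
    g′ : Fin n → Fin n
    g′ j = punchOut (g≢0 j)
    g′-inj : Injective _≡_ _≡_ g′
    g′-inj e = Fin.punchIn-injective i _ _ (g-inj (Fin.punchOut-injective (g≢0 _) (g≢0 _) e))

module _ {c ℓ} (R : CommutativeRing c ℓ) where
  open CommutativeRing R hiding (zero) renaming (refl to ≈-refl; sym to ≈-sym; trans to ≈-trans)
  open import Algebra.Properties.Ring ring using (-‿distribˡ-*; -‿distribʳ-*; -‿involutive; -1*x≈-x; -0#≈0#; [y-z]x≈yx-zx)
  open import Algebra.Properties.AbelianGroup +-abelianGroup using (⁻¹-∙-comm)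
  open import Algebra.Properties.CommutativeSemigroup +-commutativeSemigroup using () renaming (x∙yz≈y∙xz to +-middle)
  open import Algebra.Properties.CommutativeSemigroup *-commutativeSemigroup using () renaming (x∙yz≈y∙xz to *-middle; interchange to *-interchange)
  open import Relation.Binary.Reasoning.Setoid setoid
  module Sum  = FoldProperties +-commutativeMonoid
  module Prod = FoldProperties *-commutativeMonoid

  ≡⇒≈ : ∀ {x y} → x ≡ y → x ≈ y
  ≡⇒≈ refl = ≈-refl

  *-negˡ : ∀ x y → - x * y ≈ - (x * y)
  *-negˡ x y = ≈-sym (-‿distribˡ-* x y)

  *-negʳ : ∀ x y → x * - y ≈ - (x * y)
  *-negʳ x y = ≈-sym (-‿distribʳ-* x y)

  -‿distrib-+ : ∀ x y → - (x + y) ≈ - x + - y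
  -‿distrib-+ x y = ≈-sym (⁻¹-∙-comm x y)

  -‿distrib-− : ∀ x y → - (x + - y) ≈ - x + y
  -‿distrib-− x y = ≈-trans (-‿distrib-+ x (- y)) (+-congˡ (-‿involutive y))

  -‿≈0 : ∀ {x} → x ≈ 0# → - x ≈ 0#
  -‿≈0 x≈0 = ≈-trans (-‿cong x≈0) -0#≈0#

  *-≈0ˡ : ∀ {x} y → x ≈ 0# → x * y ≈ 0#
  *-≈0ˡ y x≈0 = ≈-trans (*-congʳ x≈0) (zeroˡ y)

  *-≈0ʳ : ∀ x {y} → y ≈ 0# → x * y ≈ 0#
  *-≈0ʳ x y≈0 = ≈-trans (*-congˡ y≈0) (zeroʳ x)

  sum-scale : ∀ {A : Set} (xs : List A) x (f : A → Carrier) → Sum.fold (map (λ y → x * f y) xs) ≈ x * Sum.fold (map f xs)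
  sum-scale []       x f = ≈-sym (zeroʳ x)
  sum-scale (y ∷ xs) x f = ≈-trans (+-congˡ (sum-scale xs x f)) (≈-sym (distribˡ x _ _))

  sum-neg : ∀ {n} (h : Fin n → Carrier) → Sum.sum (λ i → - h i) ≈ - Sum.sum h
  sum-neg {zero}  h = ≈-sym -0#≈0#
  sum-neg {suc n} h = ≈-trans (+-congˡ (sum-neg (h ∘ Fin.suc))) (≈-sym (-‿distrib-+ _ _))

  sign : ℕ → ℕ → Carrier
  sign x y = if x <ᵇ y then 1# else (if y <ᵇ x then - 1# else 0#)

  signWith : ℕ → List ℕ → Carrier
  signWith x ys = prodL R (map (sign x) ys)

  signList : List ℕ → Carrier
  signList []       = 1#
  signList (y ∷ ys) = signWith y ys * signList ys

  altSign : ℕ → Carrier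
  altSign zero    = 1#
  altSign (suc k) = - altSign k

  evenIndicator : ℕ → Carrier
  evenIndicator zero          = 1#
  evenIndicator (suc zero)    = 0#
  evenIndicator (suc (suc n)) = evenIndicator n

  sign-antisym : ∀ x y → sign y x ≈ - sign x y
  sign-antisym x y with compareᵇ x y
  ... | less    x<y y≮x _ rewrite x<y | y≮x = ≈-refl
  ... | equal   x≮y y≮x _ rewrite x≮y | y≮x = ≈-sym -0#≈0#
  ... | greater x≮y y<x _ rewrite x≮y | y<x = ≈-sym (-‿involutive 1#)

  sign-self : ∀ x → sign x x ≈ 0#
  sign-self x rewrite <ᵇ-irrefl x = ≈-refl

  sign-< : ∀ {x y} → x ℕ.< y → sign x y ≈ 1#
  sign-< x<y rewrite <⇒<ᵇ≡true x<y = ≈-refl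

  sign-> : ∀ {x y} → y ℕ.< x → sign x y ≈ - 1#
  sign-> {x} {y} y<x = ≈-trans (sign-antisym y x) (-‿cong (sign-< y<x))

  signWith-< : ∀ {x} ys → All (x ℕ.<_) ys → signWith x ys ≈ 1#
  signWith-< []       []             = ≈-refl
  signWith-< (y ∷ ys) (x<y ∷ x<ys) = ≈-trans (*-cong (sign-< x<y) (signWith-< ys x<ys)) (*-identityˡ 1#)

  signWith-swap : ∀ x p y z e → signWith x (p ++ z ∷ y ∷ e) ≈ signWith x (p ++ y ∷ z ∷ e)
  signWith-swap x []      y z e = *-middle (sign x z) (sign x y) (signWith x e)
  signWith-swap x (w ∷ p) y z e = *-congˡ (signWith-swap x p y z e)

  signList-swap : ∀ p y z e → signList (p ++ z ∷ y ∷ e) ≈ - signList (p ++ y ∷ z ∷ e)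
  signList-swap [] y z e = begin
    (sign z y * signWith z e) * (signWith y e * signList e)    ≈⟨ *-congʳ (*-congʳ (sign-antisym y z)) ⟩
    (- sign y z * signWith z e) * (signWith y e * signList e)  ≈⟨ *-congʳ (*-negˡ _ _) ⟩
    - (sign y z * signWith z e) * (signWith y e * signList e)  ≈⟨ *-negˡ _ _ ⟩
    - ((sign y z * signWith z e) * (signWith y e * signList e)) ≈⟨ -‿cong (*-interchange _ _ _ _) ⟩
    - ((sign y z * signWith y e) * (signWith z e * signList e)) ∎
  signList-swap (w ∷ p) y z e =
    ≈-trans (*-cong (signWith-swap w p y z e) (signList-swap p y z e)) (*-negʳ _ _)

  signList-snoc : ∀ p y w → signList ((p ++ [ y ]) ++ w) ≡ signList (p ++ y ∷ w)
  signList-snoc p y w = ≡.cong signList (++-assoc p [ y ] w)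

  signList-dup : ∀ y w → signList (y ∷ y ∷ w) ≈ 0#
  signList-dup y w = *-≈0ˡ _ (*-≈0ˡ _ (sign-self y))

  -- rowExpansion x p ys = Σ_b (-1)^b · sign x y_b · signList (p ++ ys without y_b)
  rowExpansion : ℕ → List ℕ → List ℕ → Carrier
  rowExpansion x p []       = 0#
  rowExpansion x p (y ∷ ys) = sign x y * signList (p ++ ys) + - rowExpansion x (p ++ [ y ]) ys

  rowExpansion-neg : ∀ x p p′ → (∀ w → signList (p′ ++ w) ≈ - signList (p ++ w)) →
                     ∀ e → rowExpansion x p′ e ≈ - rowExpansion x p e
  rowExpansion-neg x p p′ p′≈-p []      = ≈-sym -0#≈0#
  rowExpansion-neg x p p′ p′≈-p (y ∷ e) = begin
    sign x y * signList (p′ ++ e) + - rowExpansion x (p′ ++ [ y ]) e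
      ≈⟨ +-cong (*-congˡ (p′≈-p e)) (-‿cong (rowExpansion-neg x (p ++ [ y ]) (p′ ++ [ y ]) snoc-≈ e)) ⟩
    sign x y * - signList (p ++ e) + - - rowExpansion x (p ++ [ y ]) e
      ≈⟨ +-congʳ (*-negʳ _ _) ⟩
    - (sign x y * signList (p ++ e)) + - - rowExpansion x (p ++ [ y ]) e
      ≈⟨ ≈-sym (-‿distrib-+ _ _) ⟩
    - (sign x y * signList (p ++ e) + - rowExpansion x (p ++ [ y ]) e) ∎
    where
    snoc-≈ : ∀ w → signList ((p′ ++ [ y ]) ++ w) ≈ - signList ((p ++ [ y ]) ++ w)
    snoc-≈ w rewrite signList-snoc p′ y w | signList-snoc p y w = p′≈-p (y ∷ w)

  rowExpansion-≈0 : ∀ x p → (∀ w → signList (p ++ w) ≈ 0#) → ∀ e → rowExpansion x p e ≈ 0#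
  rowExpansion-≈0 x p p≈0 []      = ≈-refl
  rowExpansion-≈0 x p p≈0 (y ∷ e) =
    ≈-trans (+-cong (*-≈0ʳ _ (p≈0 e)) (-‿≈0 (rowExpansion-≈0 x (p ++ [ y ]) snoc-≈0 e))) (+-identityˡ 0#)
    where
    snoc-≈0 : ∀ w → signList ((p ++ [ y ]) ++ w) ≈ 0#
    snoc-≈0 w rewrite signList-snoc p y w = p≈0 (y ∷ w)

  rowExpansion-swap : ∀ x p q y z e →
                      rowExpansion x p (q ++ z ∷ y ∷ e) ≈ - rowExpansion x p (q ++ y ∷ z ∷ e)
  -- Deleting either swapped entry gives the same two summands in the other order;
  -- every later summand changes sign.
  rowExpansion-swap x p [] y z e = begin
    A + - (B′ + - C)          ≈⟨ +-cong A≈A′ (-‿cong (+-cong B′≈B (-‿cong C≈-D))) ⟩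
    A′ + - (B + - - D)        ≈⟨ +-congˡ (-‿distrib-− B (- D)) ⟩
    A′ + (- B + - D)          ≈⟨ +-middle A′ (- B) (- D) ⟩
    - B + (A′ + - D)          ≈⟨ +-congˡ (≈-sym (-‿involutive _)) ⟩
    - B + - - (A′ + - D)      ≈⟨ ≈-sym (-‿distrib-+ B (- (A′ + - D))) ⟩
    - (B + - (A′ + - D))      ∎
    where
    A  = sign x z * signList (p ++ y ∷ e)
    A′ = sign x z * signList ((p ++ [ y ]) ++ e)
    B′ = sign x y * signList ((p ++ [ z ]) ++ e)
    B  = sign x y * signList (p ++ z ∷ e)
    C  = rowExpansion x ((p ++ [ z ]) ++ [ y ]) e
    D  = rowExpansion x ((p ++ [ y ]) ++ [ z ]) e
    A≈A′ : A ≈ A′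
    A≈A′ rewrite signList-snoc p y e = ≈-refl
    B′≈B : B′ ≈ B
    B′≈B rewrite signList-snoc p z e = ≈-refl
    C≈-D : C ≈ - D
    C≈-D = rowExpansion-neg x ((p ++ [ y ]) ++ [ z ]) ((p ++ [ z ]) ++ [ y ]) swapped e
      where
      swapped : ∀ w → signList (((p ++ [ z ]) ++ [ y ]) ++ w) ≈ - signList (((p ++ [ y ]) ++ [ z ]) ++ w)
      swapped w rewrite signList-snoc (p ++ [ z ]) y w | signList-snoc (p ++ [ y ]) z w
                      | signList-snoc p z (y ∷ w) | signList-snoc p y (z ∷ w) = signList-swap p y z w
  rowExpansion-swap x p (w ∷ q) y z e = begin
    sign x w * signList (p ++ q ++ z ∷ y ∷ e) + - rowExpansion x (p ++ [ w ]) (q ++ z ∷ y ∷ e)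
      ≈⟨ +-cong (*-congˡ swapped) (-‿cong (rowExpansion-swap x (p ++ [ w ]) q y z e)) ⟩
    sign x w * - signList (p ++ q ++ y ∷ z ∷ e) + - - rowExpansion x (p ++ [ w ]) (q ++ y ∷ z ∷ e)
      ≈⟨ +-congʳ (*-negʳ _ _) ⟩
    - (sign x w * signList (p ++ q ++ y ∷ z ∷ e)) + - - rowExpansion x (p ++ [ w ]) (q ++ y ∷ z ∷ e)
      ≈⟨ ≈-sym (-‿distrib-+ _ _) ⟩
    - (sign x w * signList (p ++ q ++ y ∷ z ∷ e) + - rowExpansion x (p ++ [ w ]) (q ++ y ∷ z ∷ e)) ∎
    where
    swapped : signList (p ++ q ++ z ∷ y ∷ e) ≈ - signList (p ++ q ++ y ∷ z ∷ e)
    swapped rewrite ≡.sym (++-assoc p q (z ∷ y ∷ e)) | ≡.sym (++-assoc p q (y ∷ z ∷ e)) =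
      signList-swap (p ++ q) y z e

  ExpansionFormula : List ℕ → Set ℓ
  ExpansionFormula d = ∀ x →
    rowExpansion x [] d ≈ (signWith x d + - evenIndicator (length d)) * signList d

  formula-swap : ∀ p y z e → ExpansionFormula (p ++ y ∷ z ∷ e) → ExpansionFormula (p ++ z ∷ y ∷ e)
  formula-swap p y z e formula x = begin
    rowExpansion x [] (p ++ z ∷ y ∷ e)
      ≈⟨ rowExpansion-swap x [] p y z e ⟩
    - rowExpansion x [] (p ++ y ∷ z ∷ e)
      ≈⟨ -‿cong (formula x) ⟩
    - ((signWith x (p ++ y ∷ z ∷ e) + - evenIndicator (length (p ++ y ∷ z ∷ e))) * signList (p ++ y ∷ z ∷ e))
      ≈⟨ ≈-sym (*-negʳ _ _) ⟩
    (signWith x (p ++ y ∷ z ∷ e) + - evenIndicator (length (p ++ y ∷ z ∷ e))) * - signList (p ++ y ∷ z ∷ e)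
      ≈⟨ *-cong (+-cong (≈-sym (signWith-swap x p y z e)) (-‿cong (≡⇒≈ (≡.cong evenIndicator same-length))))
                (≈-sym (signList-swap p y z e)) ⟩
    (signWith x (p ++ z ∷ y ∷ e) + - evenIndicator (length (p ++ z ∷ y ∷ e))) * signList (p ++ z ∷ y ∷ e) ∎
    where
    same-length : length (p ++ y ∷ z ∷ e) ≡ length (p ++ z ∷ y ∷ e)
    same-length = ≡.trans (length-++ p) (≡.sym (length-++ p))

  formula-↭ : ∀ p {d d′} → d ↭ d′ → ExpansionFormula (p ++ d) → ExpansionFormula (p ++ d′)
  formula-↭ p ↭.refl formula = formula
  formula-↭ p {_ ∷ xs} {_ ∷ ys} (↭.prep x d↭d′) formula =
    ≡.subst ExpansionFormula (++-assoc p [ x ] ys)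
      (formula-↭ (p ++ [ x ]) d↭d′ (≡.subst ExpansionFormula (≡.sym (++-assoc p [ x ] xs)) formula))
  formula-↭ p {_ ∷ _ ∷ xs} {_ ∷ _ ∷ ys} (↭.swap x y d↭d′) formula =
    ≡.subst ExpansionFormula (++-assoc p (y ∷ x ∷ []) ys)
      (formula-↭ (p ++ y ∷ x ∷ []) d↭d′
        (≡.subst ExpansionFormula (≡.sym (++-assoc p (y ∷ x ∷ []) xs)) (formula-swap p x y xs formula)))
  formula-↭ p (↭.trans d↭d′ d′↭d″) formula = formula-↭ p d′↭d″ (formula-↭ p d↭d′ formula)

  evenIndicator-suc : ∀ n → evenIndicator (suc n) ≈ 1# + - evenIndicator n
  evenIndicator-suc zero          = ≈-sym (-‿inverseʳ 1#)
  evenIndicator-suc (suc zero)    = ≈-sym (≈-trans (+-congˡ -0#≈0#) (+-identityʳ 1#))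
  evenIndicator-suc (suc (suc n)) = evenIndicator-suc n

  rowExpansion-drop-min : ∀ x y p e → All (y ℕ.<_) p → All (y ℕ.<_) e →
                          rowExpansion x (y ∷ p) e ≈ rowExpansion x p e
  rowExpansion-drop-min x y p []      _   _           = ≈-refl
  rowExpansion-drop-min x y p (z ∷ e) y<p (y<z ∷ y<e) =
    +-cong (*-congˡ (≈-trans (*-congʳ (signWith-< (p ++ e) (++⁺ y<p y<e))) (*-identityˡ _)))
           (-‿cong (rowExpansion-drop-min x y (p ++ [ z ]) e (++⁺ y<p (y<z ∷ [])) y<e))

  sorted-<-all : ∀ {y z e} → y ℕ.< z → Sorted (z ∷ e) → All (y ℕ.<_) (z ∷ e)
  sorted-<-all {e = []}    y<z _              = y<z ∷ []
  sorted-<-all {e = w ∷ e} y<z (z≤w ∷ sorted) = y<z ∷ sorted-<-all (ℕ.<-≤-trans y<z z≤w) sorted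

  -- For sorted y ∷ d, either x ≤ y < d, so that signWith x d ≈ 1, or y < x, so that sign x y ≈ -1.
  sorted-step : ∀ σ q e S → q ≈ 1# ⊎ σ ≈ - 1# →
                σ * S + - ((q + - e) * S) ≈ (σ * q + - (1# + - e)) * S
  sorted-step σ q e S (inj₁ q≈1) = begin
    σ * S + - ((q + - e) * S)      ≈⟨ +-congˡ (-‿cong (*-congʳ (+-congʳ q≈1))) ⟩
    σ * S + - ((1# + - e) * S)     ≈⟨ ≈-sym ([y-z]x≈yx-zx S σ (1# + - e)) ⟩
    (σ + - (1# + - e)) * S         ≈⟨ *-congʳ (+-congʳ (≈-sym (≈-trans (*-congˡ q≈1) (*-identityʳ σ)))) ⟩
    (σ * q + - (1# + - e)) * S     ∎
  sorted-step σ q e S (inj₂ σ≈-1) = begin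
    σ * S + - ((q + - e) * S)
      ≈⟨ +-cong (≈-trans (*-congʳ σ≈-1) (-1*x≈-x S)) (-‿cong ([y-z]x≈yx-zx S q e)) ⟩
    - S + - (q * S + - (e * S))
      ≈⟨ +-congˡ (-‿distrib-− (q * S) (e * S)) ⟩
    - S + (- (q * S) + e * S)
      ≈⟨ +-middle (- S) (- (q * S)) (e * S) ⟩
    - (q * S) + (- S + e * S)
      ≈⟨ +-cong (≈-sym (*-negˡ q S)) (≈-trans (+-congʳ (-‿cong (≈-sym (*-identityˡ S)))) (≈-sym (-‿distrib-− (1# * S) (e * S)))) ⟩
    (- q) * S + - (1# * S + - (e * S))
      ≈⟨ +-congˡ (≈-trans (-‿cong (≈-sym ([y-z]x≈yx-zx S 1# e))) (≈-sym (*-negˡ (1# + - e) S))) ⟩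
    (- q) * S + (- (1# + - e)) * S
      ≈⟨ ≈-sym (distribʳ S (- q) (- (1# + - e))) ⟩
    (- q + - (1# + - e)) * S
      ≈⟨ *-congʳ (+-congʳ (≈-trans (≈-sym (-1*x≈-x q)) (*-congʳ (≈-sym σ≈-1)))) ⟩
    (σ * q + - (1# + - e)) * S ∎

  formula-sorted : ∀ {d} → Sorted d → ExpansionFormula d
  formula-sorted []  x = ≈-sym (*-≈0ˡ 1# (-‿inverseʳ 1#))
  formula-sorted [-] x = ≈-sym (≈-trans (*-congˡ (*-identityˡ 1#)) (*-identityʳ _))
  formula-sorted {y ∷ z ∷ e} (y≤z ∷ sorted) x with ℕ.m≤n⇒m<n∨m≡n y≤z
  ... | inj₂ refl = begin
    sign x y * signList (y ∷ e) + - (sign x y * signList (y ∷ e) + - rowExpansion x (y ∷ y ∷ []) e)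
      ≈⟨ +-congˡ (-‿cong (+-congˡ (-‿≈0 (rowExpansion-≈0 x (y ∷ y ∷ []) (signList-dup y) e)))) ⟩
    sign x y * signList (y ∷ e) + - (sign x y * signList (y ∷ e) + 0#)
      ≈⟨ +-congˡ (-‿cong (+-identityʳ _)) ⟩
    sign x y * signList (y ∷ e) + - (sign x y * signList (y ∷ e))
      ≈⟨ -‿inverseʳ _ ⟩
    0#
      ≈⟨ ≈-sym (*-≈0ʳ _ (signList-dup y e)) ⟩
    (signWith x (y ∷ y ∷ e) + - evenIndicator (length (y ∷ y ∷ e))) * signList (y ∷ y ∷ e) ∎
  ... | inj₁ y<z = begin
    sign x y * S + - rowExpansion x [ y ] (z ∷ e)
      ≈⟨ +-congˡ (-‿cong (rowExpansion-drop-min x y [] (z ∷ e) [] y<ze)) ⟩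
    sign x y * S + - rowExpansion x [] (z ∷ e)
      ≈⟨ +-congˡ (-‿cong (formula-sorted sorted x)) ⟩
    sign x y * S + - ((Q + - evenIndicator n) * S)
      ≈⟨ sorted-step (sign x y) Q (evenIndicator n) S x≤y⊎y<x ⟩
    (sign x y * Q + - (1# + - evenIndicator n)) * S
      ≈⟨ *-cong (+-congˡ (-‿cong (≈-sym (evenIndicator-suc n)))) (≈-sym (≈-trans (*-congʳ (signWith-< (z ∷ e) y<ze)) (*-identityˡ S))) ⟩
    (sign x y * Q + - evenIndicator (suc n)) * (signWith y (z ∷ e) * S) ∎
    where
    S = signList (z ∷ e)
    Q = signWith x (z ∷ e)
    n = length (z ∷ e)
    y<ze : All (y ℕ.<_) (z ∷ e)
    y<ze = sorted-<-all y<z sorted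
    x≤y⊎y<x : Q ≈ 1# ⊎ sign x y ≈ - 1#
    x≤y⊎y<x with ℕ.<-cmp y x
    ... | tri< y<x _ _  = inj₂ (sign-> y<x)
    ... | tri≈ _ refl _ = inj₁ (signWith-< (z ∷ e) y<ze)
    ... | tri> _ _ x<y  = inj₁ (signWith-< (z ∷ e) (All.map (ℕ.<-trans x<y) y<ze))

  expansionFormula : ∀ d → ExpansionFormula d
  expansionFormula d = formula-↭ [] (sort-↭ d) (formula-sorted (sort-↗ d))

  rowExpansion-sum : ∀ n x p (d : Fin (suc n) → ℕ) →
    Sum.sum (λ b → (altSign (toℕ b) * sign x (d b)) * signList (p ++ tabulate (d ∘ punchIn b)))
      ≈ rowExpansion x p (tabulate d)
  rowExpansion-sum zero    x p d = +-cong (*-congʳ (*-identityˡ _)) (≈-sym -0#≈0#)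
  rowExpansion-sum (suc n) x p d = +-cong (*-congʳ (*-identityˡ _)) (begin
    Sum.sum (λ b → (- altSign (toℕ b) * sign x (d (Fin.suc b))) * signList (p ++ d Fin.zero ∷ rest b))
      ≈⟨ Sum.sum-cong-≋ {suc n} (λ b → ≈-trans (*-congʳ (*-negˡ (altSign (toℕ b)) (sign x (d (Fin.suc b)))))
                                               (*-negˡ (coefficient b) (signList (p ++ d Fin.zero ∷ rest b)))) ⟩
    Sum.sum (λ b → - (coefficient b * signList (p ++ d Fin.zero ∷ rest b)))
      ≈⟨ sum-neg (λ b → coefficient b * signList (p ++ d Fin.zero ∷ rest b)) ⟩
    - Sum.sum (λ b → coefficient b * signList (p ++ d Fin.zero ∷ rest b))
      ≡⟨ ≡.cong -_ (Sum.sum-cong-≗ {suc n} λ b → ≡.cong (coefficient b *_) (≡.sym (signList-snoc p (d Fin.zero) (rest b)))) ⟩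
    - Sum.sum (λ b → coefficient b * signList ((p ++ [ d Fin.zero ]) ++ rest b))
      ≈⟨ -‿cong (rowExpansion-sum n x (p ++ [ d Fin.zero ]) (d ∘ Fin.suc)) ⟩
    - rowExpansion x (p ++ [ d Fin.zero ]) (tabulate (d ∘ Fin.suc)) ∎)
    where
    coefficient : Fin (suc n) → Carrier
    coefficient b = altSign (toℕ b) * sign x (d (Fin.suc b))
    rest : Fin (suc n) → List ℕ
    rest b = tabulate (d ∘ Fin.suc ∘ punchIn b)

  parity≈altSign : ∀ k → (if k % 2 ≡ᵇ 0 then 1# else - 1#) ≈ altSign k
  parity≈altSign zero          = ≈-refl
  parity≈altSign (suc zero)    = ≈-refl
  parity≈altSign (suc (suc k)) rewrite [2+k]%2≡k%2 k = ≈-trans (parity≈altSign k) (≈-sym (-‿involutive _))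

  pairSigns : ∀ {A : Set} (a b : A → ℕ) → List A → Carrier
  pairSigns a b ps = prodL R (map (λ p → sign (a p) (b p)) ps)

  pairSigns-if : ∀ {A : Set} (a b : A → ℕ) ps →
    (if allB (λ p → not (a p ≡ᵇ b p)) ps then altSign (length (filter (λ p → b p ℕ.<? a p) ps)) else 0#)
      ≈ pairSigns a b ps
  pairSigns-if a b []       = ≈-refl
  pairSigns-if a b (p ∷ ps) with compareᵇ (a p) (b p)
  ... | less a<b b≮a a≢b rewrite a≢b | b≮a | a<b =
    ≈-trans (pairSigns-if a b ps) (≈-sym (*-identityˡ _))
  ... | equal a≮b b≮a a≡b rewrite a≡b = ≈-sym (≈-trans (*-congʳ (≡⇒≈ sign≡0)) (zeroˡ _))
    where
    sign≡0 : sign (a p) (b p) ≡ 0#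
    sign≡0 rewrite a≮b | b≮a = refl
  ... | greater a≮b b<a a≢b rewrite a≢b | b<a | a≮b = begin
    (if allB (λ p → not (a p ≡ᵇ b p)) ps then - altSign (length (filter (λ p → b p ℕ.<? a p) ps)) else 0#)
      ≈⟨ if-neg (allB (λ p → not (a p ≡ᵇ b p)) ps) (length (filter (λ p → b p ℕ.<? a p) ps)) ⟩
    - (if allB (λ p → not (a p ≡ᵇ b p)) ps then altSign (length (filter (λ p → b p ℕ.<? a p) ps)) else 0#)
      ≈⟨ -‿cong (pairSigns-if a b ps) ⟩
    - pairSigns a b ps
      ≈⟨ ≈-sym (-1*x≈-x _) ⟩
    - 1# * pairSigns a b ps ∎
    where
    if-neg : ∀ (β : Bool) k → (if β then - altSign k else 0#) ≈ - (if β then altSign k else 0#)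
    if-neg true  k = ≈-refl
    if-neg false k = ≈-sym -0#≈0#

  pairSigns-orderedPairs : ∀ n (t : Fin n → ℕ) →
    pairSigns (t ∘ proj₁) (t ∘ proj₂) (orderedPairs n) ≈ signList (tabulate t)
  pairSigns-orderedPairs zero    t = ≈-refl
  pairSigns-orderedPairs (suc n) t = begin
    prodL R (map h (orderedPairs (suc n)))
      ≡⟨ ≡.cong (prodL R ∘ map h) (orderedPairs-suc n) ⟩
    prodL R (map h (map (Fin.zero ,_) (tabulate Fin.suc) ++ map suc² (orderedPairs n)))
      ≡⟨ ≡.cong (prodL R) (map-++ h (map (Fin.zero ,_) (tabulate Fin.suc)) _) ⟩
    prodL R (map h (map (Fin.zero ,_) (tabulate Fin.suc)) ++ map h (map suc² (orderedPairs n)))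
      ≈⟨ Prod.fold-++ (map h (map (Fin.zero ,_) (tabulate Fin.suc))) _ ⟩
    prodL R (map h (map (Fin.zero ,_) (tabulate Fin.suc))) * prodL R (map h (map suc² (orderedPairs n)))
      ≡⟨ ≡.cong₂ _*_ first-row rest ⟩
    signWith (t Fin.zero) (tabulate (t ∘ Fin.suc)) * pairSigns (t ∘ Fin.suc ∘ proj₁) (t ∘ Fin.suc ∘ proj₂) (orderedPairs n)
      ≈⟨ *-congˡ (pairSigns-orderedPairs n (t ∘ Fin.suc)) ⟩
    signList (tabulate t) ∎
    where
    h : Fin (suc n) × Fin (suc n) → Carrier
    h (i , j) = sign (t i) (t j)
    suc² : Fin n × Fin n → Fin (suc n) × Fin (suc n)
    suc² = Product.map Fin.suc Fin.suc
    first-row : prodL R (map h (map (Fin.zero ,_) (tabulate Fin.suc))) ≡ signWith (t Fin.zero) (tabulate (t ∘ Fin.suc))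
    first-row = ≡.cong (prodL R) (≡.trans (≡.sym (map-∘ (tabulate Fin.suc)))
                  (≡.trans (map-tabulate Fin.suc (λ j → sign (t Fin.zero) (t j)))
                     (≡.sym (map-tabulate (t ∘ Fin.suc) (sign (t Fin.zero))))))
    rest : prodL R (map h (map suc² (orderedPairs n))) ≡ pairSigns (t ∘ Fin.suc ∘ proj₁) (t ∘ Fin.suc ∘ proj₂) (orderedPairs n)
    rest = ≡.cong (prodL R) (≡.sym (map-∘ (orderedPairs n)))

  sgn≈signList : ∀ n (t : Fin n → ℕ) → sgn R n t ≈ signList (tabulate t)
  sgn≈signList n t = begin
    sgn R n t                                                       ≈⟨ parity-to-altSign ⟩
    (if distinctB n t then altSign (inversions n t) else 0#)        ≈⟨ pairSigns-if (t ∘ proj₁) (t ∘ proj₂) (orderedPairs n) ⟩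
    pairSigns (t ∘ proj₁) (t ∘ proj₂) (orderedPairs n)              ≈⟨ pairSigns-orderedPairs n t ⟩
    signList (tabulate t)                                           ∎
    where
    parity-to-altSign : sgn R n t ≈ (if distinctB n t then altSign (inversions n t) else 0#)
    parity-to-altSign with distinctB n t
    ... | true  = parity≈altSign (inversions n t)
    ... | false = ≈-refl

  record IsΠ (m : ℕ) (π : Fin (m ℕ.* 2) → Fin (m ℕ.* 2)) : Set where
    field
      injective : Injective _≡_ _≡_ π
      pair-<    : ∀ (l : Fin m) → π (oddPos R l) Fin.< π (evenPos R l)
      odd-<     : ∀ {l l′ : Fin m} → suc (toℕ l) ≡ toℕ l′ → π (oddPos R l) Fin.< π (oddPos R l′)

  -- The last two conjuncts of isΠ R m π, named so that they can be passed to allB⁻ and allB⁺.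
  module _ {m} (π : Fin (m ℕ.* 2) → Fin (m ℕ.* 2)) where
    pairTest : Fin m → Bool
    pairTest l = toℕ (π (oddPos R l)) <ᵇ toℕ (π (evenPos R l))

    chainTest : Fin m × Fin m → Bool
    chainTest (l , l′) = if suc (toℕ l) ≡ᵇ toℕ l′ then toℕ (π (oddPos R l)) <ᵇ toℕ (π (oddPos R l′)) else true

  isΠ⇒IsΠ : ∀ {m π} → isΠ R m π ≡ true → IsΠ m π
  isΠ⇒IsΠ {m} {π} π∈Π = record
    { injective = distinctB⇒injective π distinct
    ; pair-<    = λ l → <ᵇ≡true⇒< (allB⁻ {p = pairTest π} pairs (∈-allFin l))
    ; odd-<     = odd-<
    }
    where
    distinct : distinctB (m ℕ.* 2) (toℕ ∘ π) ≡ true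
    distinct = proj₁ (∧-≡true⁻ π∈Π)
    pairs : allB (pairTest π) (allFin m) ≡ true
    pairs = proj₁ (∧-≡true⁻ (proj₂ (∧-≡true⁻ {distinctB (m ℕ.* 2) (toℕ ∘ π)} π∈Π)))
    chain : allB (chainTest π) (orderedPairs m) ≡ true
    chain = proj₂ (∧-≡true⁻ (proj₂ (∧-≡true⁻ {distinctB (m ℕ.* 2) (toℕ ∘ π)} π∈Π)))
    odd-< : ∀ {l l′} → suc (toℕ l) ≡ toℕ l′ → π (oddPos R l) Fin.< π (oddPos R l′)
    odd-< {l} {l′} l′≡1+l = <ᵇ≡true⇒< (≡.subst (λ t → (if t then toℕ (π (oddPos R l)) <ᵇ toℕ (π (oddPos R l′)) else true) ≡ true)
      (≡⇒≡ᵇ≡true l′≡1+l) (allB-orderedPairs⁻ {p = chainTest π} chain (ℕ.≤-reflexive l′≡1+l)))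

  IsΠ⇒isΠ : ∀ {m π} → IsΠ m π → isΠ R m π ≡ true
  IsΠ⇒isΠ {m} {π} π∈Π =
    ∧-≡true⁺ (injective⇒distinctB π (IsΠ.injective π∈Π))
      (∧-≡true⁺ (allB⁺ {p = pairTest π} (allFin m) (λ {l} _ → <⇒<ᵇ≡true (IsΠ.pair-< π∈Π l)))
                (allB-orderedPairs⁺ {p = chainTest π} chain))
    where
    chain : ∀ {l l′ : Fin m} → l Fin.< l′ → chainTest π (l , l′) ≡ true
    chain {l} {l′} _ with suc (toℕ l) ≡ᵇ toℕ l′ in l′≡ᵇ1+l
    ... | true  = <⇒<ᵇ≡true (IsΠ.odd-< π∈Π (≡ᵇ≡true⇒≡ l′≡ᵇ1+l))
    ... | false = refl

  -- Each entry of π but the first exceeds some other entry: at an even position its partner,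
  -- at an odd position the previous odd one.
  IsΠ-preimage-zero : ∀ {m π} → IsΠ (suc m) π → ∀ i → π i ≡ Fin.zero → i ≡ Fin.zero
  IsΠ-preimage-zero {m} {π} π∈Π i πi≡0 with Fin.combine-surjective {suc m} {2} i
  ... | Fin.zero  , Fin.zero , refl = refl
  ... | Fin.suc l , Fin.zero , refl = ⊥-elim (ℕ.n≮0 (≡.subst (λ v → π (oddPos R (Fin.inject₁ l)) Fin.< v) πi≡0
                                                         (IsΠ.odd-< π∈Π (≡.cong suc (Fin.toℕ-inject₁ l)))))
  ... | l , Fin.suc Fin.zero , refl = ⊥-elim (ℕ.n≮0 (≡.subst (λ v → π (oddPos R l) Fin.< v) πi≡0 (IsΠ.pair-< π∈Π l)))

  IsΠ-fixes-zero : ∀ {m π} → IsΠ (suc m) π → π Fin.zero ≡ Fin.zero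
  IsΠ-fixes-zero {m} {π} π∈Π with injective⇒preimage π (IsΠ.injective π∈Π) Fin.zero
  ... | i , πi≡0 = ≡.subst (λ j → π j ≡ Fin.zero) (IsΠ-preimage-zero π∈Π i πi≡0) πi≡0

  module _ {m} (b : Fin (suc (m ℕ.* 2))) (g : Fin (m ℕ.* 2) → Fin (m ℕ.* 2)) where
    IsΠ-insertPair⁺ : IsΠ m g → IsΠ (suc m) (insertPair b g)
    IsΠ-insertPair⁺ g∈Π = record
      { injective = insertPair-injective b (IsΠ.injective g∈Π)
      ; pair-<    = pair-<
      ; odd-<     = odd-<
      }
      where
      pair-< : ∀ l → insertPair b g (oddPos R l) Fin.< insertPair b g (evenPos R l)
      pair-< Fin.zero    = ℕ.s≤s ℕ.z≤n
      pair-< (Fin.suc l) = relabel-mono-< b (IsΠ.pair-< g∈Π l)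
      odd-< : ∀ {l l′} → suc (toℕ l) ≡ toℕ l′ → insertPair b g (oddPos R l) Fin.< insertPair b g (oddPos R l′)
      odd-< {Fin.zero}  {Fin.suc l′} _     = ℕ.s≤s ℕ.z≤n
      odd-< {Fin.suc l} {Fin.suc l′} l′≡1+l = relabel-mono-< b (IsΠ.odd-< g∈Π (ℕ.suc-injective l′≡1+l))

    IsΠ-insertPair⁻ : IsΠ (suc m) (insertPair b g) → IsΠ m g
    IsΠ-insertPair⁻ π∈Π = record
      { injective = insertPair-injective⁻ b (IsΠ.injective π∈Π)
      ; pair-<    = λ l → relabel-cancel-< b (IsΠ.pair-< π∈Π (Fin.suc l))
      ; odd-<     = λ l′≡1+l → relabel-cancel-< b (IsΠ.odd-< π∈Π (≡.cong suc l′≡1+l))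
      }

    isΠ-insertPair : isΠ R (suc m) (insertPair b g) ≡ isΠ R m g
    isΠ-insertPair = true-⇔⇒≡ (IsΠ⇒isΠ ∘ IsΠ-insertPair⁻ ∘ isΠ⇒IsΠ) (IsΠ⇒isΠ ∘ IsΠ-insertPair⁺ ∘ isΠ⇒IsΠ)

  sign-punchIn : ∀ {n} (b : Fin (suc n)) v →
                 sign (toℕ b) (toℕ (punchIn b v)) ≡ (if toℕ v <ᵇ toℕ b then - 1# else 1#)
  sign-punchIn Fin.zero    v           = refl
  sign-punchIn (Fin.suc b) Fin.zero    = refl
  sign-punchIn (Fin.suc b) (Fin.suc v) = sign-punchIn b v

  prod-below≈altSign : ∀ n k → k ℕ.≤ n → Prod.sum (λ (v : Fin n) → if toℕ v <ᵇ k then - 1# else 1#) ≈ altSign k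
  prod-below≈altSign zero    zero    _           = ≈-refl
  prod-below≈altSign (suc n) zero    _           = ≈-trans (*-identityˡ _) (prod-below≈altSign n zero ℕ.z≤n)
  prod-below≈altSign (suc n) (suc k) (ℕ.s≤s k≤n) = ≈-trans (*-congˡ (prod-below≈altSign n k k≤n)) (-1*x≈-x (altSign k))

  signWith-relabel : ∀ {n} (b : Fin (suc n)) u (vs : List (Fin n)) →
                     signWith (toℕ (relabel b u)) (map (toℕ ∘ relabel b) vs) ≡ signWith (toℕ u) (map toℕ vs)
  signWith-relabel b u []       = refl
  signWith-relabel b u (v ∷ vs) = ≡.cong₂ _*_ same-sign (signWith-relabel b u vs)
    where
    same-sign : sign (toℕ (relabel b u)) (toℕ (relabel b v)) ≡ sign (toℕ u) (toℕ v)
    same-sign rewrite punchIn-<ᵇ b u v | punchIn-<ᵇ b v u = refl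

  signList-relabel : ∀ {n} (b : Fin (suc n)) (vs : List (Fin n)) →
                     signList (map (toℕ ∘ relabel b) vs) ≡ signList (map toℕ vs)
  signList-relabel b []       = refl
  signList-relabel b (v ∷ vs) = ≡.cong₂ _*_ (signWith-relabel b v vs) (signList-relabel b vs)

  -- The entry 0 is below all others, b + 1 is above exactly b of the relabelled entries,
  -- and relabelling preserves their order.
  sgn-insertPair : ∀ {n} (b : Fin (suc n)) (g : Fin n → Fin n) → Injective _≡_ _≡_ g →
                   sgn R (suc (suc n)) (toℕ ∘ insertPair b g) ≈ altSign (toℕ b) * sgn R n (toℕ ∘ g)
  sgn-insertPair {n} b g g-inj = begin
    sgn R (suc (suc n)) (toℕ ∘ insertPair b g)
      ≈⟨ sgn≈signList (suc (suc n)) (toℕ ∘ insertPair b g) ⟩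
    signWith 0 (tabulate (toℕ ∘ insertPair b g ∘ Fin.suc)) * (signWith (suc (toℕ b)) rest * signList rest)
      ≈⟨ *-cong (signWith-< {0} (tabulate (toℕ ∘ insertPair b g ∘ Fin.suc)) (tabulate⁺ {f = toℕ ∘ insertPair b g ∘ Fin.suc} λ { Fin.zero → ℕ.z<s ; (Fin.suc i) → ℕ.z<s }))
                (*-cong first-row rest-relabel) ⟩
    1# * (altSign (toℕ b) * signList (tabulate (toℕ ∘ g)))
      ≈⟨ *-identityˡ _ ⟩
    altSign (toℕ b) * signList (tabulate (toℕ ∘ g))
      ≈⟨ *-congˡ (≈-sym (sgn≈signList n (toℕ ∘ g))) ⟩
    altSign (toℕ b) * sgn R n (toℕ ∘ g) ∎
    where
    rest = tabulate (toℕ ∘ relabel b ∘ g)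
    below : Fin n → Carrier
    below v = if toℕ v <ᵇ toℕ b then - 1# else 1#
    first-row : signWith (suc (toℕ b)) rest ≈ altSign (toℕ b)
    first-row = begin
      prodL R (map (sign (suc (toℕ b))) rest)            ≡⟨ ≡.cong (prodL R) (map-tabulate (toℕ ∘ relabel b ∘ g) (sign (suc (toℕ b)))) ⟩
      prodL R (tabulate (λ i → sign (toℕ b) (toℕ (punchIn b (g i)))))
                                                         ≡⟨ Prod.fold-tabulate (λ i → sign (toℕ b) (toℕ (punchIn b (g i)))) ⟩
      Prod.sum (λ i → sign (toℕ b) (toℕ (punchIn b (g i))))
                                                         ≡⟨ Prod.sum-cong-≗ (λ i → sign-punchIn b (g i)) ⟩
      Prod.sum (below ∘ g)                               ≈⟨ Prod.sum-injective g g-inj below ⟩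
      Prod.sum below                                     ≈⟨ prod-below≈altSign n (toℕ b) (ℕ.≤-pred (Fin.toℕ<n b)) ⟩
      altSign (toℕ b)                                    ∎
    rest-relabel : signList rest ≈ signList (tabulate (toℕ ∘ g))
    rest-relabel = begin
      signList rest                                      ≡⟨ ≡.cong signList (≡.sym (map-tabulate g (toℕ ∘ relabel b))) ⟩
      signList (map (toℕ ∘ relabel b) (tabulate g))      ≡⟨ signList-relabel b (tabulate g) ⟩
      signList (map toℕ (tabulate g))                    ≡⟨ ≡.cong signList (map-tabulate g toℕ) ⟩
      signList (tabulate (toℕ ∘ g))                      ∎

  pfTerm : ∀ m → (Fin (m ℕ.* 2) → Fin (m ℕ.* 2) → Carrier) → (Fin (m ℕ.* 2) → Fin (m ℕ.* 2)) → Carrier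
  pfTerm m Y π = sgn R (m ℕ.* 2) (toℕ ∘ π) * prodL R (map (λ l → Y (π (oddPos R l)) (π (evenPos R l))) (allFin m))

  pfSummand : ∀ m → (Fin (m ℕ.* 2) → Fin (m ℕ.* 2) → Carrier) → (Fin (m ℕ.* 2) → Fin (m ℕ.* 2)) → Carrier
  pfSummand m Y π = if isΠ R m π then pfTerm m Y π else 0#

  pfSummand-if : ∀ m Y π {β} → isΠ R m π ≡ β → pfSummand m Y π ≈ (if β then pfTerm m Y π else 0#)
  pfSummand-if m Y π refl = ≈-refl

  pf≈sum-pfSummand : ∀ m Y → pf R m Y ≈ Sum.fold (map (pfSummand m Y) (allFuns R (m ℕ.* 2) (m ℕ.* 2)))
  pf≈sum-pfSummand m Y = Sum.fold-filter (isΠ R m) (pfTerm m Y) (allFuns R (m ℕ.* 2) (m ℕ.* 2))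

  sgn-cong : ∀ n {t t′ : Fin n → ℕ} → t ≗ t′ → sgn R n t ≈ sgn R n t′
  sgn-cong n {t} {t′} t≗t′ =
    ≈-trans (sgn≈signList n t) (≈-trans (≡⇒≈ (≡.cong signList (tabulate-cong t≗t′))) (≈-sym (sgn≈signList n t′)))

  IsΠ-resp-≗ : ∀ {m π π′} → π ≗ π′ → IsΠ m π → IsΠ m π′
  IsΠ-resp-≗ π≗π′ π∈Π = record
    { injective = λ e → IsΠ.injective π∈Π (≡.trans (π≗π′ _) (≡.trans e (≡.sym (π≗π′ _))))
    ; pair-<    = λ l → ≡.subst₂ Fin._<_ (π≗π′ _) (π≗π′ _) (IsΠ.pair-< π∈Π l)
    ; odd-<     = λ l′≡1+l → ≡.subst₂ Fin._<_ (π≗π′ _) (π≗π′ _) (IsΠ.odd-< π∈Π l′≡1+l)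
    }

  isΠ-cong : ∀ m {π π′} → π ≗ π′ → isΠ R m π ≡ isΠ R m π′
  isΠ-cong m π≗π′ = true-⇔⇒≡ (IsΠ⇒isΠ ∘ IsΠ-resp-≗ {m} π≗π′ ∘ isΠ⇒IsΠ)
                              (IsΠ⇒isΠ ∘ IsΠ-resp-≗ {m} (≡.sym ∘ π≗π′) ∘ isΠ⇒IsΠ)

  pfSummand-cong : ∀ m Y → pfSummand m Y Preserves _≗_ ⟶ _≈_
  pfSummand-cong m Y {π} {π′} π≗π′ rewrite isΠ-cong m π≗π′ with isΠ R m π′
  ... | true  = *-cong (sgn-cong (m ℕ.* 2) (≡.cong toℕ ∘ π≗π′))
                       (Prod.fold-map-cong (allFin m) (λ l → ≡⇒≈ (≡.cong₂ Y (π≗π′ _) (π≗π′ _))))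
  ... | false = ≈-refl

  pfSummand-≈0 : ∀ m Y π → ¬ IsΠ m π → pfSummand m Y π ≈ 0#
  pfSummand-≈0 m Y π π∉Π with isΠ R m π in π∈Π
  ... | true  = ⊥-elim (π∉Π (isΠ⇒IsΠ π∈Π))
  ... | false = ≈-refl

  -- allFuns builds its functions as pattern lambdas, which agree with a ∷ᵛ f only pointwise.
  sum-allFuns-suc : ∀ k n (H : (Fin (suc k) → Fin n) → Carrier) → H Preserves _≗_ ⟶ _≈_ →
                    Sum.fold (map H (allFuns R (suc k) n)) ≈
                    Sum.fold (map (λ f → Sum.sum (λ a → H (a ∷ᵛ f))) (allFuns R k n))
  sum-allFuns-suc k n H H-cong = ≈-trans (Sum.fold-concatMap _ H (allFuns R k n))
    (Sum.fold-map-cong (allFuns R k n) λ f →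
      ≈-trans (≡⇒≈ (Sum.fold-map-allFin {n = n} _ H))
              (Sum.sum-cong-≋ (λ a → H-cong {y = a ∷ᵛ f} λ { Fin.zero → refl ; (Fin.suc i) → refl })))

  sum-allFuns-relabel : ∀ n k (b : Fin (suc n)) (G : (Fin k → Fin (suc (suc n))) → Carrier) →
    G Preserves _≗_ ⟶ _≈_ → (∀ f i → f i ≡ Fin.zero ⊎ f i ≡ Fin.suc b → G f ≈ 0#) →
    Sum.fold (map G (allFuns R k (suc (suc n)))) ≈ Sum.fold (map (λ g → G (relabel b ∘ g)) (allFuns R k n))
  sum-allFuns-relabel n zero    b G G-cong G-≈0 = +-congʳ (G-cong (λ ()))
  sum-allFuns-relabel n (suc k) b G G-cong G-≈0 = begin
    Sum.fold (map G (allFuns R (suc k) (suc (suc n))))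
      ≈⟨ sum-allFuns-suc k _ G G-cong ⟩
    Sum.fold (map G′ (allFuns R k (suc (suc n))))
      ≈⟨ sum-allFuns-relabel n k b G′ G′-cong G′-≈0 ⟩
    Sum.fold (map (λ g → G′ (relabel b ∘ g)) (allFuns R k n))
      ≈⟨ Sum.fold-map-cong (allFuns R k n) (λ g →
           Sum.sum-relabel b (λ a → G (a ∷ᵛ relabel b ∘ g)) (G-≈0 _ Fin.zero (inj₁ refl)) (G-≈0 _ Fin.zero (inj₂ refl))) ⟩
    Sum.fold (map (λ g → Sum.sum (λ a → G (relabel b a ∷ᵛ relabel b ∘ g))) (allFuns R k n))
      ≈⟨ Sum.fold-map-cong (allFuns R k n) (λ g →
           Sum.sum-cong-≋ (λ a → G-cong {y = relabel b ∘ (a ∷ᵛ g)} (λ { Fin.zero → refl ; (Fin.suc i) → refl }))) ⟩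
    Sum.fold (map (λ g → Sum.sum (λ a → G (relabel b ∘ (a ∷ᵛ g)))) (allFuns R k n))
      ≈⟨ ≈-sym (sum-allFuns-suc k n (λ g → G (relabel b ∘ g)) (λ g≗g′ → G-cong (≡.cong (relabel b) ∘ g≗g′))) ⟩
    Sum.fold (map (λ g → G (relabel b ∘ g)) (allFuns R (suc k) n)) ∎
    where
    G′ : (Fin k → Fin (suc (suc n))) → Carrier
    G′ f = Sum.sum (λ a → G (a ∷ᵛ f))
    G′-cong : G′ Preserves _≗_ ⟶ _≈_
    G′-cong {f} {f′} f≗f′ = Sum.sum-cong-≋ (λ a → G-cong {a ∷ᵛ f} {a ∷ᵛ f′} (λ { Fin.zero → refl ; (Fin.suc i) → f≗f′ i }))
    G′-≈0 : ∀ f i → f i ≡ Fin.zero ⊎ f i ≡ Fin.suc b → G′ f ≈ 0#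
    G′-≈0 f i hit = Sum.sum-≈ε _ (λ a → G-≈0 (a ∷ᵛ f) (Fin.suc i) hit)

  minor : ∀ {n} → Fin (suc n) → (Fin (suc (suc n)) → Fin (suc (suc n)) → Carrier) → Fin n → Fin n → Carrier
  minor b Y u v = Y (relabel b u) (relabel b v)

  module _ {m} (Y : Fin (suc m ℕ.* 2) → Fin (suc m ℕ.* 2) → Carrier) where
    private
      N = m ℕ.* 2
      K = suc (suc N)
      coefficient : Fin (suc N) → Carrier
      coefficient b = altSign (toℕ b) * Y Fin.zero (Fin.suc b)
      H = pfSummand (suc m) Y
      H-cong = pfSummand-cong (suc m) Y
      H-≈0 = pfSummand-≈0 (suc m) Y

    pfTerm-insertPair : ∀ b g → Injective _≡_ _≡_ g →
                        pfTerm (suc m) Y (insertPair b g) ≈ coefficient b * pfTerm m (minor b Y) g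
    pfTerm-insertPair b g g-inj = begin
      sgn R (suc m ℕ.* 2) (toℕ ∘ insertPair b g) * prodL R (map entries (allFin (suc m)))
        ≈⟨ *-cong (sgn-insertPair b g g-inj) (≡⇒≈ split) ⟩
      (altSign (toℕ b) * sgn R N (toℕ ∘ g)) * (Y Fin.zero (Fin.suc b) * prodL R (map (entries ∘ Fin.suc) (allFin m)))
        ≈⟨ *-interchange _ _ _ _ ⟩
      coefficient b * pfTerm m (minor b Y) g ∎
      where
      entries : Fin (suc m) → Carrier
      entries l = Y (insertPair b g (oddPos R l)) (insertPair b g (evenPos R l))
      split : prodL R (map entries (allFin (suc m))) ≡ Y Fin.zero (Fin.suc b) * prodL R (map (entries ∘ Fin.suc) (allFin m))
      split = ≡.trans (Prod.fold-allFin entries) (≡.cong (Y Fin.zero (Fin.suc b) *_) (≡.sym (Prod.fold-allFin (entries ∘ Fin.suc))))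

    pfSummand-insertPair : ∀ b g → pfSummand (suc m) Y (insertPair b g) ≈ coefficient b * pfSummand m (minor b Y) g
    pfSummand-insertPair b g with isΠ R m g in g∈Π
    ... | true  = ≈-trans (pfSummand-if (suc m) Y (insertPair b g) (≡.trans (isΠ-insertPair {m} b g) g∈Π))
                          (pfTerm-insertPair b g (IsΠ.injective (isΠ⇒IsΠ {m} {g} g∈Π)))
    ... | false = ≈-trans (pfSummand-if (suc m) Y (insertPair b g) (≡.trans (isΠ-insertPair {m} b g) g∈Π))
                          (≈-sym (zeroʳ _))

    sum-pfSummand-first : ∀ f → Sum.sum (λ a → H (a ∷ᵛ f)) ≈ H (Fin.zero ∷ᵛ f)
    sum-pfSummand-first f =
      ≈-trans (+-congˡ (Sum.sum-≈ε _ λ a → H-≈0 (Fin.suc a ∷ᵛ f) λ π∈Π → Fin.0≢1+n (≡.sym (IsΠ-fixes-zero π∈Π))))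
              (+-identityʳ _)

    sum-pfSummand-second : ∀ f → Sum.sum (λ b → H (Fin.zero ∷ᵛ b ∷ᵛ f)) ≈ Sum.sum (λ b → H (Fin.zero ∷ᵛ Fin.suc b ∷ᵛ f))
    sum-pfSummand-second f =
      ≈-trans (+-congʳ (H-≈0 (Fin.zero ∷ᵛ Fin.zero ∷ᵛ f) λ π∈Π → Fin.0≢1+n (IsΠ.injective π∈Π {Fin.zero} {Fin.suc Fin.zero} refl)))
              (+-identityˡ _)

    sum-pfSummand-rest : ∀ b → Sum.fold (map (λ f → H (Fin.zero ∷ᵛ Fin.suc b ∷ᵛ f)) (allFuns R N K)) ≈
                               coefficient b * pf R m (minor b Y)
    sum-pfSummand-rest b = begin
      Sum.fold (map (λ f → H (Fin.zero ∷ᵛ Fin.suc b ∷ᵛ f)) (allFuns R N K))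
        ≈⟨ sum-allFuns-relabel N N b _ (λ {f} {f′} f≗f′ → H-cong {Fin.zero ∷ᵛ Fin.suc b ∷ᵛ f} {Fin.zero ∷ᵛ Fin.suc b ∷ᵛ f′}
                                          λ { Fin.zero → refl ; (Fin.suc Fin.zero) → refl ; (Fin.suc (Fin.suc i)) → f≗f′ i })
                                      collision ⟩
      Sum.fold (map (λ g → H (Fin.zero ∷ᵛ Fin.suc b ∷ᵛ relabel b ∘ g)) (allFuns R N N))
        ≈⟨ Sum.fold-map-cong (allFuns R N N) (λ g → ≈-trans (H-cong (insertPair-≗ g)) (pfSummand-insertPair b g)) ⟩
      Sum.fold (map (λ g → coefficient b * pfSummand m (minor b Y) g) (allFuns R N N))
        ≈⟨ sum-scale (allFuns R N N) (coefficient b) (pfSummand m (minor b Y)) ⟩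
      coefficient b * Sum.fold (map (pfSummand m (minor b Y)) (allFuns R N N))
        ≈⟨ *-congˡ (≈-sym (pf≈sum-pfSummand m (minor b Y))) ⟩
      coefficient b * pf R m (minor b Y) ∎
      where
      insertPair-≗ : ∀ g → (Fin.zero ∷ᵛ Fin.suc b ∷ᵛ relabel b ∘ g) ≗ insertPair b g
      insertPair-≗ g Fin.zero              = refl
      insertPair-≗ g (Fin.suc Fin.zero)    = refl
      insertPair-≗ g (Fin.suc (Fin.suc i)) = refl
      collision : ∀ f i → f i ≡ Fin.zero ⊎ f i ≡ Fin.suc b → H (Fin.zero ∷ᵛ Fin.suc b ∷ᵛ f) ≈ 0#
      collision f i (inj₁ fi≡0) = H-≈0 (Fin.zero ∷ᵛ Fin.suc b ∷ᵛ f) λ π∈Π →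
        case IsΠ.injective π∈Π {Fin.suc (Fin.suc i)} {Fin.zero} fi≡0 of λ ()
      collision f i (inj₂ fi≡b) = H-≈0 (Fin.zero ∷ᵛ Fin.suc b ∷ᵛ f) λ π∈Π →
        case IsΠ.injective π∈Π {Fin.suc (Fin.suc i)} {Fin.suc Fin.zero} fi≡b of λ ()

    pf-expand : pf R (suc m) Y ≈ Sum.sum (λ b → coefficient b * pf R m (minor b Y))
    pf-expand = begin
      pf R (suc m) Y                                                              ≈⟨ pf≈sum-pfSummand (suc m) Y ⟩
      Sum.fold (map H (allFuns R K K))                                            ≈⟨ sum-allFuns-suc (suc N) K H H-cong ⟩
      Sum.fold (map (λ f → Sum.sum (λ a → H (a ∷ᵛ f))) (allFuns R (suc N) K))    ≈⟨ Sum.fold-map-cong (allFuns R (suc N) K) sum-pfSummand-first ⟩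
      Sum.fold (map (λ f → H (Fin.zero ∷ᵛ f)) (allFuns R (suc N) K))
        ≈⟨ sum-allFuns-suc N K (λ f → H (Fin.zero ∷ᵛ f))
             (λ {f} {f′} f≗f′ → H-cong {Fin.zero ∷ᵛ f} {Fin.zero ∷ᵛ f′} λ { Fin.zero → refl ; (Fin.suc i) → f≗f′ i }) ⟩
      Sum.fold (map (λ f → Sum.sum (λ b → H (Fin.zero ∷ᵛ b ∷ᵛ f))) (allFuns R N K))
        ≈⟨ Sum.fold-map-cong (allFuns R N K) sum-pfSummand-second ⟩
      Sum.fold (map (λ f → Sum.sum (λ b → H (Fin.zero ∷ᵛ Fin.suc b ∷ᵛ f))) (allFuns R N K))
        ≈⟨ Sum.fold-sum-comm (λ f b → H (Fin.zero ∷ᵛ Fin.suc b ∷ᵛ f)) (allFuns R N K) ⟩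
      Sum.sum (λ b → Sum.fold (map (λ f → H (Fin.zero ∷ᵛ Fin.suc b ∷ᵛ f)) (allFuns R N K)))
        ≈⟨ Sum.sum-cong-≋ sum-pfSummand-rest ⟩
      Sum.sum (λ b → coefficient b * pf R m (minor b Y)) ∎

  SGN-entry : ∀ n (t : Fin n → ℕ) i j → SGN R n t i j ≈ sign (t i) (t j)
  SGN-entry n t i j with compareᵇ (t i) (t j)
  ... | less    i<j j≮i i≢j rewrite i≢j | j≮i | i<j = ≈-refl
  ... | equal   i≮j j≮i i≡j rewrite i≡j | j≮i | i≮j = ≈-refl
  ... | greater i≮j j<i i≢j rewrite i≢j | j<i | i≮j = ≈-refl

  pf-cong : ∀ m {Y Y′ : Fin (m ℕ.* 2) → Fin (m ℕ.* 2) → Carrier} → (∀ u v → Y u v ≈ Y′ u v) → pf R m Y ≈ pf R m Y′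
  pf-cong m Y≈Y′ = Sum.fold-map-cong (Π R m) (λ π → *-congˡ (Prod.fold-map-cong (allFin m) (λ l → Y≈Y′ _ _)))

  evenIndicator-odd : ∀ m → evenIndicator (suc (m ℕ.* 2)) ≈ 0#
  evenIndicator-odd zero    = ≈-refl
  evenIndicator-odd (suc m) = evenIndicator-odd m

  pf-SGN≈sgn : ∀ m (c : Fin (m ℕ.* 2) → ℕ) → pf R m (SGN R (m ℕ.* 2) c) ≈ sgn R (m ℕ.* 2) c
  pf-SGN≈sgn zero    c = ≈-trans (pf≈sum-pfSummand 0 (SGN R 0 c)) (≈-trans (+-identityʳ _) (*-identityʳ _))
  pf-SGN≈sgn (suc m) c = begin
    pf R (suc m) (SGN R (suc m ℕ.* 2) c)
      ≈⟨ pf-expand {m} (SGN R (suc m ℕ.* 2) c) ⟩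
    Sum.sum (λ b → (altSign (toℕ b) * SGN R (suc m ℕ.* 2) c Fin.zero (Fin.suc b)) * pf R m (minor b (SGN R (suc m ℕ.* 2) c)))
      ≈⟨ Sum.sum-cong-≋ {suc (m ℕ.* 2)} (λ b → *-cong (*-congˡ {altSign (toℕ b)} (SGN-entry (suc m ℕ.* 2) c Fin.zero (Fin.suc b))) (minor-pf b)) ⟩
    Sum.sum (λ b → (altSign (toℕ b) * sign x (d b)) * signList ([] ++ tabulate (d ∘ punchIn b)))
      ≈⟨ rowExpansion-sum (m ℕ.* 2) x [] d ⟩
    rowExpansion x [] (tabulate d)
      ≈⟨ expansionFormula (tabulate d) x ⟩
    (signWith x (tabulate d) + - evenIndicator (length (tabulate d))) * signList (tabulate d)
      ≈⟨ *-congʳ (≈-trans (+-congˡ (-‿≈0 odd-length)) (+-identityʳ _)) ⟩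
    signList (tabulate c)
      ≈⟨ ≈-sym (sgn≈signList (suc m ℕ.* 2) c) ⟩
    sgn R (suc m ℕ.* 2) c ∎
    where
    x = c Fin.zero
    d = c ∘ Fin.suc
    odd-length : evenIndicator (length (tabulate d)) ≈ 0#
    odd-length = ≈-trans (≡⇒≈ (≡.cong evenIndicator (length-tabulate d))) (evenIndicator-odd m)
    minor-pf : ∀ b → pf R m (minor b (SGN R (suc m ℕ.* 2) c)) ≈ signList (tabulate (d ∘ punchIn b))
    minor-pf b = begin
      pf R m (minor b (SGN R (suc m ℕ.* 2) c))
        ≈⟨ pf-cong m (λ u v → ≈-trans (SGN-entry (suc m ℕ.* 2) c (relabel b u) (relabel b v)) (≈-sym (SGN-entry (m ℕ.* 2) (c ∘ relabel b) u v))) ⟩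
      pf R m (SGN R (m ℕ.* 2) (c ∘ relabel b))
        ≈⟨ pf-SGN≈sgn m (c ∘ relabel b) ⟩
      sgn R (m ℕ.* 2) (c ∘ relabel b)
        ≈⟨ sgn≈signList (m ℕ.* 2) (c ∘ relabel b) ⟩
      signList (tabulate (d ∘ punchIn b)) ∎

open import Data.Nat.Base using (_*_)

lemma7 : ∀ {a ℓ : Level} (F : Field a ℓ) (m : ℕ) (c : Fin (m * 2) → ℕ) →
    Field._≈_ F (pf (Field.commutativeRing F) m (SGN (Field.commutativeRing F) (m * 2) c))
                (sgn (Field.commutativeRing F) (m * 2) c)
lemma7 F = pf-SGN≈sgn (Field.commutativeRing F)
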